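{- Let $s,D\in\mathbb N$, let $\mathcal G=\{G_1,\dots,G_t\}$ be a graph family, let $\mathcal H'$ be a $[t]$-edge-colored rooted graph with $\Delta^{mon}(\mathcal H')\le D$, and let $\phi':\mathcal H'\hookrightarrow\mathcal G$ be an $(s,D)$-good embedding. Then for every graph $\mathcal H$ obtained from $\mathcal H'$ by successively removing a non-root vertex of degree $1$, the restriction $\phi$ of $\phi'$ to $\mathcal H$ is also $(s,D)$-good.
   Context: $\mathcal G$ is a family of graphs on a common vertex set $V$. A $[t]$-edge-colored graph has edges colored from $[t]$; $H_i$ is its subgraph of color-$i$ edges; $\Delta^{mon}=\max_i\Delta(H_i)$. An embedding is an injective map $\phi:V(\mathcal H)\to V$ with $\phi(x)\phi(y)\in E(G_i)$ for every edge $xy$ of color $i$. For $X\subseteq V\times[t]$, $\Gamma_{\mathcal G}(X)=\bigcup_{(v,i)\in X}\Gamma_{G_i}(v)$. A rooted graph has a distinguished root set such that each non-root vertex $h$ has a unique path to the root set meeting it only at its last vertex; the neighbour of $h$ on it is its parent (roots of $\mathcal H'$ remain roots in $\mathcal H$). $R(X,\phi)=|\Gamma_{\mathcal G}(X)\setminus\phi(V(\mathcal H))|-\sum_{(v,i)\in X}[D-\deg_{H_i}(\phi^{ -1}(v))]-|P_\phi(\mathcal H)\cap X|$, with $\deg_{H_i}(\phi^{ -1}(v))=0$ for $v\notin\phi(V(\mathcal H))$ and $P_\phi(\mathcal H)$ the set of $(\phi(h),i)$ with $h$ non-root and $i$ the color of the edge from $h$ to its parent. $\phi$ is $(s,D)$-good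 if $R(X,\phi)\ge0$ for all $X\subseteq V\times[t]$ with $|X|\le s$. -}

module Defs where

open import Data.Nat using (ℕ; zero; suc; _+_; _≤_)
open import Data.Integer as ℤ using (ℤ; +_)
open import Data.Fin using (Fin; zero; suc; _≟_)
open import Data.Bool using (Bool; true; false; _∧_; _∨_; not; if_then_else_)
open import Data.Maybe using (Maybe; just; nothing; is-just)
open import Data.Product using (Σ; ∃; _×_; _,_)
open import Data.List using (List; []; _∷_; [_]; length; foldr)
open import Data.Bool.ListAction using (any)
open import Data.List.Relation.Unary.Unique.Propositional using (Unique)
open import Data.List.Membership.Propositional using (_∈_)
open import Relation.Binary.PropositionalEquality using (_≡_)
open import Relation.Nullary.Decidable using (⌊_⌋)
open import Relation.Binary.Construct.Closure.ReflexiveTransitive using (Star)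
open import Function.Definitions using (Injective)

countB : ∀ {m} → (Fin m → Bool) → ℕ
countB {zero}  p = 0
countB {suc m} p = (if p zero then 1 else 0) + countB (λ x → p (suc x))

sumFin : ∀ {m} → (Fin m → ℕ) → ℕ
sumFin {zero}  f = 0
sumFin {suc m} f = f zero + sumFin (λ x → f (suc x))

anyFin : ∀ {m} → (Fin m → Bool) → Bool
anyFin {zero}  p = false
anyFin {suc m} p = p zero ∨ anyFin (λ x → p (suc x))

_==ᶠ_ : ∀ {n} → Fin n → Fin n → Bool
x ==ᶠ y = ⌊ x ≟ y ⌋

-- Cardinality of an arbitrary (not necessarily decidable) subset of A:
-- "P has exactly k elements".
CardIs : ∀ {A : Set} → (A → Set) → ℕ → Set
CardIs {A} P k = Σ (List A) λ xs →
  Unique xs × length xs ≡ k × (∀ a → a ∈ xs → P a) × (∀ a → P a → a ∈ xs)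

record Graph (n : ℕ) : Set where
  field
    adj    : Fin n → Fin n → Bool
    sym    : ∀ x y → adj x y ≡ adj y x
    irrefl : ∀ x → adj x x ≡ false
open Graph public

Family : ℕ → ℕ → Set
Family n t = Fin t → Graph n

-- [t]-edge-coloured graphs on Fin m with a distinguished root set.
-- col x y = just i  : xy is an edge of colour i ;  nothing : no edge.

record ColGraph (m t : ℕ) : Set where
  field
    col    : Fin m → Fin m → Maybe (Fin t)
    csym   : ∀ x y → col x y ≡ col y x
    cirr   : ∀ x → col x x ≡ nothing
    isRoot : Fin m → Bool
open ColGraph public

-- Vertex subsets of H (the current subgraph is the induced subgraph on S)
VSet : ℕ → Set
VSet m = Fin m → Bool

full : ∀ {m} → VSet m
full _ = true

module _ {m t : ℕ} (H : ColGraph m t) where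

  Adj : Fin m → Fin m → Set
  Adj x y = is-just (col H x y) ≡ true

  degC : VSet m → Fin t → Fin m → ℕ
  degC S i h = countB (λ y → S y ∧ Data.Maybe.maybe (λ j → j ==ᶠ i) false (col H h y))

  deg : VSet m → Fin m → ℕ
  deg S h = countB (λ y → S y ∧ is-just (col H h y))

  MonDegLe : VSet m → ℕ → Set
  MonDegLe S D = ∀ (i : Fin t) (h : Fin m) → S h ≡ true → degC S i h ≤ D

  data RootWalk (S : VSet m) : List (Fin m) → Set where
    stop : ∀ r → S r ≡ true → isRoot H r ≡ true → RootWalk S [ r ]
    step : ∀ x y ys → S x ≡ true → isRoot H x ≡ false → Adj x y →
           RootWalk S (y ∷ ys) → RootWalk S (x ∷ y ∷ ys)

  RootPath : VSet m → Fin m → List (Fin m) → Set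
  RootPath S h ys = RootWalk S (h ∷ ys) × Unique (h ∷ ys)

  Rooted : VSet m → Set
  Rooted S = ∀ h → S h ≡ true → isRoot H h ≡ false →
    Σ (List (Fin m)) (λ ys → RootPath S h ys) ×
    (∀ ys zs → RootPath S h ys → RootPath S h zs → ys ≡ zs)

  ParentIn : VSet m → Fin m → Fin m → Set
  ParentIn S h p = Σ (List (Fin m)) λ ys → RootPath S h (p ∷ ys)

  RemStep : VSet m → VSet m → Set
  RemStep S S' = Σ (Fin m) λ v → S v ≡ true × isRoot H v ≡ false × deg S v ≡ 1 ×
                 (∀ x → S' x ≡ (S x ∧ not (x ==ᶠ v)))

  Obtainable : VSet m → Set
  Obtainable S = Star RemStep full S

module _ {n m t : ℕ} (G : Family n t) (H : ColGraph m t) where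

  Embedding : (Fin m → Fin n) → Set
  Embedding φ = Injective _≡_ _≡_ φ ×
    (∀ x y i → col H x y ≡ just i → adj (G i) (φ x) (φ y) ≡ true)

  module _ (S : VSet m) (φ : Fin m → Fin n) where

    inImage : Fin n → Bool
    inImage w = anyFin (λ h → S h ∧ (φ h ==ᶠ w))

    gammaCount : List (Fin n × Fin t) → ℕ
    gammaCount X = countB (λ w →
      any (λ { (v , i) → adj (G i) v w }) X ∧ not (inImage w))

    -- deg_{H_i}(φ⁻¹(v)), which is 0 if v ∉ φ(V(H[S]))  (φ injective)
    degPre : Fin n → Fin t → ℕ
    degPre v i = sumFin (λ h → if S h ∧ (φ h ==ᶠ v) then degC H S i h else 0)

    defSum : ℕ → List (Fin n × Fin t) → ℤ
    defSum D X = foldr (λ { (v , i) acc → (+ D ℤ.- + degPre v i) ℤ.+ acc }) (+ 0) X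

    InP : Fin n × Fin t → Set
    InP a = ∃ λ h → ∃ λ p → ∃ λ i →
      ParentIn H S h p × col H h p ≡ just i × a ≡ (φ h , i)

    Good : ℕ → ℕ → Set
    Good s D = ∀ (X : List (Fin n × Fin t)) → Unique X → length X ≤ s →
      ∀ k → CardIs (λ a → a ∈ X × InP a) k →
      + 0 ℤ.≤ ((+ gammaCount X ℤ.- defSum D X) ℤ.- + k)

{-# OPTIONS --safe #-}
module Submission where

-- Deleting a non-root leaf v, joined to its parent p by an edge of colour c, can only
-- increase R(X, φ). The pair (φ v, c) loses its degree 1 but also leaves P_φ; the pair
-- (φ p, c) loses degree 1 too, but if it lies in X then φ v, a G_c-neighbour of φ p,
-- becomes a new vertex of Γ_𝒢(X) ∖ φ(V(H)). All other parent relations survive, since a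
-- root path of another vertex cannot pass through a leaf.

open import Defs hiding (sym)
open import Data.Bool using (Bool; true; false; _∧_; _∨_; not; if_then_else_)
import Data.Bool.Properties as BoolP
open import Data.Bool.ListAction using (any)
open import Data.Fin using (Fin; zero; suc; _≟_)
open import Data.Fin.Properties using (suc-injective; any?)
open import Data.Integer as ℤ using (ℤ; +_; +≤+)
import Data.Integer.Properties as ℤP
open import Data.Integer.Tactic.RingSolver using (solve-∀)
open import Data.List using (List; []; _∷_; map)
open import Data.Nat.ListAction using (sum)
open import Data.List.Membership.Propositional using (_∈_; _∉_)
open import Data.List.Relation.Unary.All as All using (_∷_)
open import Data.List.Relation.Unary.AllPairs using (_∷_)
open import Data.List.Relation.Unary.Any using (here; there)
open import Data.List.Relation.Unary.Unique.Propositional using (Unique)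
open import Data.Maybe using (Maybe; just; nothing; is-just; maybe)
open import Data.Maybe.Properties using (just-injective)
open import Data.Nat using (ℕ; zero; suc; _+_; _≤_; _<_; z≤n; s≤s)
open import Data.Nat.Properties
  using (≤-refl; ≤-reflexive; ≤-trans; +-mono-≤; +-monoʳ-≤; +-mono-≤-<; m≤m+n; m≤n+m;
         +-comm; +-assoc; +-identityʳ; module ≤-Reasoning)
open import Data.Product using (∃; ∃₂; _×_; _,_; proj₁; proj₂)
open import Data.Product.Properties using (≡-dec)
open import Data.Sum using (_⊎_; inj₁; inj₂)
import Data.Sum as Sum
open import Function using (_∘_)
open import Function.Definitions using (Injective)
open import Relation.Binary.Construct.Closure.ReflexiveTransitive using (Star; ε; _◅_)
open import Relation.Binary.Definitions using (DecidableEquality)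
open import Relation.Binary.PropositionalEquality
open import Relation.Nullary using (¬_; Dec; yes; no; contradiction; _×-dec_)
open import Relation.Nullary.Decidable using (⌊_⌋)

indicator : Bool → ℕ
indicator b = if b then 1 else 0

indicator-mono : ∀ {a b} → (a ≡ true → b ≡ true) → indicator a ≤ indicator b
indicator-mono {false} _ = z≤n
indicator-mono {true} a⇒b rewrite a⇒b refl = ≤-refl

∧-trueˡ : ∀ {a b} → a ∧ b ≡ true → a ≡ true
∧-trueˡ {true} _ = refl

∧-trueʳ : ∀ {a b} → a ∧ b ≡ true → b ≡ true
∧-trueʳ {true} b≡true = b≡true

∧-true : ∀ {a b} → a ≡ true → b ≡ true → a ∧ b ≡ true
∧-true refl refl = refl

∧-false : ∀ {a b} → (a ≡ true → b ≡ false) → a ∧ b ≡ false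
∧-false {false} _ = refl
∧-false {true} a⇒¬b = a⇒¬b refl

not-antitone : ∀ {a b} → (a ≡ true → b ≡ true) → not b ≡ true → not a ≡ true
not-antitone {false} _ _ = refl
not-antitone {true} a⇒b not-b rewrite a⇒b refl = not-b

module _ {A : Set} where

  ⌊⌋-sound : (a? : Dec A) → ⌊ a? ⌋ ≡ true → A
  ⌊⌋-sound (yes a) _ = a
  ⌊⌋-sound (no _) ()

  ⌊⌋-complete : (a? : Dec A) → A → ⌊ a? ⌋ ≡ true
  ⌊⌋-complete (yes _) _ = refl
  ⌊⌋-complete (no ¬a) a = contradiction a ¬a

  ⌊⌋-false : (a? : Dec A) → ¬ A → ⌊ a? ⌋ ≡ false
  ⌊⌋-false (yes a) ¬a = contradiction a ¬a
  ⌊⌋-false (no _) _ = refl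

  ⌊⌋-false-sound : (a? : Dec A) → not ⌊ a? ⌋ ≡ true → ¬ A
  ⌊⌋-false-sound (yes _) ()
  ⌊⌋-false-sound (no ¬a) _ = ¬a

is-just⇒≡just : ∀ {A : Set} {mb : Maybe A} → is-just mb ≡ true → ∃ λ a → mb ≡ just a
is-just⇒≡just {mb = just a} _ = a , refl
is-just⇒≡just {mb = nothing} ()

hasColour : ∀ {t} → Fin t → Maybe (Fin t) → Bool
hasColour i = maybe (λ j → j ==ᶠ i) false

hasColour⇒≡just : ∀ {t} {i : Fin t} {mb} → hasColour i mb ≡ true → mb ≡ just i
hasColour⇒≡just {i = i} {just j} j==i = cong just (⌊⌋-sound (j ≟ i) j==i)
hasColour⇒≡just {mb = nothing} ()

infix 4 _⊆_
_⊆_ : ∀ {m} → (Fin m → Bool) → (Fin m → Bool) → Set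
p ⊆ q = ∀ x → p x ≡ true → q x ≡ true

countB-mono : ∀ {m} {p q : Fin m → Bool} → p ⊆ q → countB p ≤ countB q
countB-mono {zero} _ = z≤n
countB-mono {suc m} p⊆q = +-mono-≤ (indicator-mono (p⊆q zero)) (countB-mono (λ x → p⊆q (suc x)))

countB-mono-< : ∀ {m} {p q : Fin m → Bool} (w : Fin m) →
                p ⊆ q → p w ≡ false → q w ≡ true → countB p < countB q
countB-mono-< zero p⊆q pw qw rewrite pw | qw = s≤s (countB-mono (λ x → p⊆q (suc x)))
countB-mono-< (suc w) p⊆q pw qw =
  +-mono-≤-< (indicator-mono (p⊆q zero)) (countB-mono-< w (λ x → p⊆q (suc x)) pw qw)

countB-except : ∀ {m} {p q : Fin m → Bool} (v : Fin m) →
                (∀ x → x ≢ v → p x ≡ true → q x ≡ true) → countB p ≤ countB q + indicator (p v)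
countB-except {p = p} {q} zero p⊆q = begin
  indicator (p zero) + countB (p ∘ suc)
    ≤⟨ +-monoʳ-≤ (indicator (p zero))
         (≤-trans (countB-mono (λ x → p⊆q (suc x) λ ())) (m≤n+m _ (indicator (q zero)))) ⟩
  indicator (p zero) + countB q  ≡⟨ +-comm _ (countB q) ⟩
  countB q + indicator (p zero)  ∎
  where open ≤-Reasoning
countB-except {p = p} {q} (suc v) p⊆q = begin
  indicator (p zero) + countB (p ∘ suc)
    ≤⟨ +-mono-≤ (indicator-mono (p⊆q zero λ ()))
                (countB-except v λ x x≢v → p⊆q (suc x) (x≢v ∘ suc-injective)) ⟩
  indicator (q zero) + (countB (q ∘ suc) + indicator (p (suc v)))
    ≡⟨ +-assoc (indicator (q zero)) _ _ ⟨
  countB q + indicator (p (suc v)) ∎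
  where open ≤-Reasoning

countB-false : ∀ m → countB {m} (λ _ → false) ≡ 0
countB-false zero = refl
countB-false (suc m) = countB-false m

countB-pos : ∀ {m} {p : Fin m → Bool} (a : Fin m) → p a ≡ true → 1 ≤ countB p
countB-pos zero pa rewrite pa = s≤s z≤n
countB-pos {p = p} (suc a) pa = ≤-trans (countB-pos a pa) (m≤n+m _ (indicator (p zero)))

countB≡1⇒unique : ∀ {m} {p : Fin m → Bool} → countB p ≡ 1 →
                  ∀ {a b} → p a ≡ true → p b ≡ true → a ≡ b
countB≡1⇒unique {p = p} count≡1 {a} {b} pa pb with a ≟ b
... | yes a≡b = a≡b
... | no a≢b = contradiction (≤-trans two≤count (≤-reflexive count≡1)) λ { (s≤s ()) }
  where
  two≤count : 2 ≤ countB p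
  two≤count = ≤-trans
    (s≤s (countB-pos {p = λ x → p x ∧ not (x ==ᶠ b)} a (∧-true pa (cong not (⌊⌋-false (a ≟ b) a≢b)))))
    (countB-mono-< b (λ _ → ∧-trueˡ) (∧-false λ _ → cong not (⌊⌋-complete (b ≟ b) refl)) pb)

anyFin-intro : ∀ {m} {p : Fin m → Bool} (x : Fin m) → p x ≡ true → anyFin p ≡ true
anyFin-intro zero px rewrite px = refl
anyFin-intro {p = p} (suc x) px = trans (cong (p zero ∨_) (anyFin-intro x px)) (BoolP.∨-zeroʳ (p zero))

anyFin-witness : ∀ {m} {p : Fin m → Bool} → anyFin p ≡ true → ∃ λ x → p x ≡ true
anyFin-witness {suc m} {p} any-p with p zero in p0
... | true = zero , p0
... | false = let x , px = anyFin-witness any-p in suc x , px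

anyFin-mono : ∀ {m} {p q : Fin m → Bool} → p ⊆ q → anyFin p ≡ true → anyFin q ≡ true
anyFin-mono p⊆q any-p = let x , px = anyFin-witness any-p in anyFin-intro x (p⊆q x px)

anyFin-false : ∀ {m} {p : Fin m → Bool} → (∀ x → p x ≡ false) → anyFin p ≡ false
anyFin-false {zero} _ = refl
anyFin-false {suc m} p≡false rewrite p≡false zero = anyFin-false (λ x → p≡false (suc x))

sumFin-zero : ∀ {m} {f : Fin m → ℕ} → (∀ x → f x ≡ 0) → sumFin f ≡ 0
sumFin-zero {zero} _ = refl
sumFin-zero {suc m} f≡0 rewrite f≡0 zero = sumFin-zero (λ x → f≡0 (suc x))

sumFin-point : ∀ {m} {f : Fin m → ℕ} (a : Fin m) → (∀ x → x ≢ a → f x ≡ 0) → sumFin f ≡ f a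
sumFin-point {f = f} zero f≡0 =
  trans (cong (_+_ (f zero)) (sumFin-zero λ x → f≡0 (suc x) λ ())) (+-identityʳ (f zero))
sumFin-point {f = f} (suc a) f≡0 rewrite f≡0 zero (λ ()) =
  sumFin-point a λ x x≢a → f≡0 (suc x) (x≢a ∘ suc-injective)

any-intro : ∀ {A : Set} {f : A → Bool} {x xs} → x ∈ xs → f x ≡ true → any f xs ≡ true
any-intro (here refl) fx rewrite fx = refl
any-intro {f = f} {xs = y ∷ _} (there x∈xs) fx =
  trans (cong (f y ∨_) (any-intro x∈xs fx)) (BoolP.∨-zeroʳ (f y))

module _ {A : Set} (_≟_ : DecidableEquality A) where

  count : A → List A → ℕ
  count a xs = sum (map (λ x → indicator ⌊ x ≟ a ⌋) xs)

  count-∉ : ∀ {a xs} → a ∉ xs → count a xs ≡ 0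
  count-∉ {xs = []} _ = refl
  count-∉ {a} {x ∷ xs} a∉ rewrite ⌊⌋-false (x ≟ a) (λ x≡a → a∉ (here (sym x≡a))) = count-∉ (a∉ ∘ there)

  count-∈-unique : ∀ {a xs} → Unique xs → a ∈ xs → count a xs ≡ 1
  count-∈-unique {xs = x ∷ _} (x∉xs ∷ _) (here refl) rewrite ⌊⌋-complete (x ≟ x) refl =
    cong suc (count-∉ λ x∈xs → All.lookup x∉xs x∈xs refl)
  count-∈-unique {a} {x ∷ _} (x∉xs ∷ unique) (there a∈xs)
    rewrite ⌊⌋-false (x ≟ a) (All.lookup x∉xs a∈xs) = count-∈-unique unique a∈xs

module _ {A : Set} {P Q : A → Set} where

  CardIs-resp : (∀ a → P a → Q a) → (∀ a → Q a → P a) → ∀ {k} → CardIs P k → CardIs Q k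
  CardIs-resp P⇒Q Q⇒P (xs , unique , len , sound , complete) =
    xs , unique , len , (λ a a∈xs → P⇒Q a (sound a a∈xs)) , (λ a Qa → complete a (Q⇒P a Qa))

  CardIs-insert : ∀ {b k} → ¬ P b → Q b → (∀ a → P a → Q a) → (∀ a → Q a → a ≡ b ⊎ P a) →
                  CardIs P k → CardIs Q (suc k)
  CardIs-insert {b} ¬Pb Qb P⇒Q Q⇒b⊎P (xs , unique , len , sound , complete) =
    b ∷ xs , All.tabulate (λ a∈xs b≡a → ¬Pb (subst P (sym b≡a) (sound _ a∈xs))) ∷ unique ,
    cong suc len , sound′ , complete′
    where
    sound′ : ∀ a → a ∈ b ∷ xs → Q a
    sound′ a (here refl) = Qb
    sound′ a (there a∈xs) = P⇒Q a (sound a a∈xs)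
    complete′ : ∀ a → Q a → a ∈ b ∷ xs
    complete′ a Qa with Q⇒b⊎P a Qa
    ... | inj₁ refl = here refl
    ... | inj₂ Pa = there (complete a Pa)

deficit-mono : ∀ D {g g′ e} → g ≤ g′ + e → + D ℤ.- + g′ ℤ.≤ (+ D ℤ.- + g) ℤ.+ + e
deficit-mono D {g} {g′} {e} g≤g′+e = begin
  + D ℤ.- + g′                      ≡⟨ shift (+ D) (+ g′) (+ e) ⟩
  (+ D ℤ.- (+ g′ ℤ.+ + e)) ℤ.+ + e  ≡⟨ cong (λ z → (+ D ℤ.- z) ℤ.+ + e) (ℤP.pos-+ g′ e) ⟨
  (+ D ℤ.- + (g′ + e)) ℤ.+ + e
    ≤⟨ ℤP.+-monoˡ-≤ (+ e) (ℤP.+-monoʳ-≤ (+ D) (ℤP.neg-mono-≤ (+≤+ g≤g′+e))) ⟩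
  (+ D ℤ.- + g) ℤ.+ + e             ∎
  where
  open ℤP.≤-Reasoning
  shift : ∀ d x y → d ℤ.- x ≡ (d ℤ.- (x ℤ.+ y)) ℤ.+ y
  shift = solve-∀

regroup : ∀ (x y : ℤ) (p q r s : ℕ) →
          (x ℤ.+ + (p + q)) ℤ.+ (y ℤ.+ + (r + s)) ≡ (x ℤ.+ y) ℤ.+ + ((p + r) + (q + s))
regroup x y p q r s
  rewrite ℤP.pos-+ p q | ℤP.pos-+ r s | ℤP.pos-+ (p + r) (q + s) | ℤP.pos-+ p r | ℤP.pos-+ q s =
  ring x y (+ p) (+ q) (+ r) (+ s)
  where
  ring : ∀ x y p q r s → (x ℤ.+ (p ℤ.+ q)) ℤ.+ (y ℤ.+ (r ℤ.+ s)) ≡ (x ℤ.+ y) ℤ.+ ((p ℤ.+ r) ℤ.+ (q ℤ.+ s))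
  ring = solve-∀

-- γ, δ and k are the three terms of R(X, φ) = (γ − δ) − k.
residual-mono : ∀ {γ γ′ k a b : ℕ} {δ δ′ : ℤ} → γ + b ≤ γ′ → δ′ ℤ.≤ δ ℤ.+ + (a + b) →
                (+ γ ℤ.- δ) ℤ.- + (k + a) ℤ.≤ (+ γ′ ℤ.- δ′) ℤ.- + k
residual-mono {γ} {γ′} {k} {a} {b} {δ} {δ′} γ+b≤γ′ δ′≤δ+a+b = begin
  (+ γ ℤ.- δ) ℤ.- + (k + a)                          ≡⟨ cong (λ z → (+ γ ℤ.- δ) ℤ.- z) (ℤP.pos-+ k a) ⟩
  (+ γ ℤ.- δ) ℤ.- (+ k ℤ.+ + a)                      ≡⟨ shuffle (+ γ) δ (+ k) (+ a) (+ b) ⟩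
  ((+ γ ℤ.+ + b) ℤ.- (δ ℤ.+ (+ a ℤ.+ + b))) ℤ.- + k
    ≡⟨ cong₂ (λ x y → (x ℤ.- (δ ℤ.+ y)) ℤ.- + k) (ℤP.pos-+ γ b) (ℤP.pos-+ a b) ⟨
  (+ (γ + b) ℤ.- (δ ℤ.+ + (a + b))) ℤ.- + k
    ≤⟨ ℤP.+-monoˡ-≤ (ℤ.- + k) (ℤP.+-mono-≤ (+≤+ γ+b≤γ′) (ℤP.neg-mono-≤ δ′≤δ+a+b)) ⟩
  (+ γ′ ℤ.- δ′) ℤ.- + k                              ∎
  where
  open ℤP.≤-Reasoning
  shuffle : ∀ g d k a b → (g ℤ.- d) ℤ.- (k ℤ.+ a) ≡ ((g ℤ.+ b) ℤ.- (d ℤ.+ (a ℤ.+ b))) ℤ.- k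
  shuffle = solve-∀

_≟ₚ_ : ∀ {n t} → DecidableEquality (Fin n × Fin t)
_≟ₚ_ = ≡-dec _≟_ _≟_

Adj-sym : ∀ {m t} (H : ColGraph m t) {x y} → Adj H x y → Adj H y x
Adj-sym H {x} {y} x~y = trans (cong is-just (csym H y x)) x~y

module _ {m t} {H : ColGraph m t} where

  walk-head : ∀ {S x ys} → RootWalk H S (x ∷ ys) → S x ≡ true
  walk-head (stop _ Sr _) = Sr
  walk-head (step _ _ _ Sx _ _ _) = Sx

  walk-mono : ∀ {S S′} → S ⊆ S′ → ∀ {xs} → RootWalk H S xs → RootWalk H S′ xs
  walk-mono S⊆S′ (stop r Sr root) = stop r (S⊆S′ r Sr) root
  walk-mono S⊆S′ (step x y ys Sx nonroot x~y rest) =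
    step x y ys (S⊆S′ x Sx) nonroot x~y (walk-mono S⊆S′ rest)

  ParentIn-∈ : ∀ {S h p} → ParentIn H S h p → S p ≡ true
  ParentIn-∈ (_ , step _ _ _ _ _ _ rest , _) = walk-head rest

RootPaths : ∀ {m t} → ColGraph m t → VSet m → Set
RootPaths H S = ∀ h → S h ≡ true → isRoot H h ≡ false → ∃ (RootPath H S h)

module _ {n m t} (G : Family n t) (H : ColGraph m t) (φ : Fin m → Fin n) where

  degPre-image : Injective _≡_ _≡_ φ → ∀ {S h} i → S h ≡ true → degPre G H S φ (φ h) i ≡ degC H S i h
  degPre-image φ-inj {S} {h} i Sh = trans
    (sumFin-point h λ x x≢h → cong (λ b → if b then degC H S i x else 0)
       (∧-false {S x} λ _ → ⌊⌋-false (φ x ≟ φ h) (x≢h ∘ φ-inj)))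
    (cong (λ b → if b then degC H S i h else 0) (∧-true Sh (⌊⌋-complete (φ h ≟ φ h) refl)))

  degPre-outside : ∀ {S w} i → (∀ h → S h ≡ true → φ h ≢ w) → degPre G H S φ w i ≡ 0
  degPre-outside {w = w} i outside = sumFin-zero λ h → cong (λ b → if b then _ else 0)
    (∧-false λ Sh → ⌊⌋-false (φ h ≟ w) (outside h Sh))

  module _ {S S′ : VSet m} (S′⊆S : S′ ⊆ S) where

    inImage-mono : ∀ w → inImage G H S′ φ w ≡ true → inImage G H S φ w ≡ true
    inImage-mono w = anyFin-mono λ h e → ∧-true (S′⊆S h (∧-trueˡ e)) (∧-trueʳ e)

    gammaCount-antitone : ∀ X → gammaCount G H S φ X ≤ gammaCount G H S′ φ X
    gammaCount-antitone X = countB-mono λ w e → ∧-true (∧-trueˡ e) (not-antitone (inImage-mono w) (∧-trueʳ e))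

    gammaCount-vacated : ∀ X {u i w} → (u , i) ∈ X → adj (G i) u w ≡ true →
                         inImage G H S φ w ≡ true → inImage G H S′ φ w ≡ false →
                         gammaCount G H S φ X < gammaCount G H S′ φ X
    gammaCount-vacated X {w = w} ui∈X u~w w∈φ[S] w∉φ[S′] = countB-mono-< w
      (λ x e → ∧-true (∧-trueˡ e) (not-antitone (inImage-mono x) (∧-trueʳ e)))
      (∧-false λ _ → cong not w∈φ[S])
      (∧-true (any-intro ui∈X u~w) (cong not w∉φ[S′]))

  module _ {S S′ : VSet m} (a b : Fin n × Fin t → ℕ)
           (degPre-bound : ∀ w i → degPre G H S φ w i ≤ degPre G H S′ φ w i + (a (w , i) + b (w , i)))
           (D : ℕ) where

    defSum-mono : ∀ X → defSum G H S′ φ D X ℤ.≤ defSum G H S φ D X ℤ.+ + (sum (map a X) + sum (map b X))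
    defSum-mono [] = ℤP.≤-refl
    defSum-mono ((w , i) ∷ X) = ℤP.≤-trans
      (ℤP.+-mono-≤ (deficit-mono D {g′ = degPre G H S′ φ w i} (degPre-bound w i)) (defSum-mono X))
      (ℤP.≤-reflexive (regroup (+ D ℤ.- + degPre G H S φ w i) (defSum G H S φ D X)
                                (a (w , i)) (b (w , i)) (sum (map a X)) (sum (map b X))))

module LeafRemoval {m t} (H : ColGraph m t) {S S′ : VSet m} {v : Fin m}
  (Sv : S v ≡ true) (v-nonroot : isRoot H v ≡ false) (deg-v : deg H S v ≡ 1)
  (S′≡S-v : ∀ x → S′ x ≡ (S x ∧ not (x ==ᶠ v))) where

  S′⊆S : S′ ⊆ S
  S′⊆S x S′x = ∧-trueˡ (trans (sym (S′≡S-v x)) S′x)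

  S′-≢ : ∀ {x} → S′ x ≡ true → x ≢ v
  S′-≢ {x} S′x = ⌊⌋-false-sound (x ≟ v) (∧-trueʳ {S x} (trans (sym (S′≡S-v x)) S′x))

  S′-intro : ∀ {x} → S x ≡ true → x ≢ v → S′ x ≡ true
  S′-intro {x} Sx x≢v = trans (S′≡S-v x) (∧-true Sx (cong not (⌊⌋-false (x ≟ v) x≢v)))

  neighbour-unique : ∀ {a b} → S a ≡ true → Adj H v a → S b ≡ true → Adj H v b → a ≡ b
  neighbour-unique Sa v~a Sb v~b = countB≡1⇒unique deg-v (∧-true Sa v~a) (∧-true Sb v~b)

  -- v has a single neighbour, so on a root path it could only be the last vertex, a root.
  walk-second-≢v : ∀ {x y ys} → RootWalk H S (x ∷ y ∷ ys) → Unique (x ∷ y ∷ ys) → y ≢ v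
  walk-second-≢v (step _ _ [] _ _ _ (stop _ _ v-root)) _ refl =
    contradiction (trans (sym v-root) v-nonroot) λ ()
  walk-second-≢v (step _ _ (_ ∷ _) Sx _ x~v (step _ _ _ _ _ v~z rest)) ((_ ∷ x≢z ∷ _) ∷ _) refl =
    x≢z (neighbour-unique Sx (Adj-sym H x~v) (walk-head rest) v~z)

  walk-restrict : ∀ {x ys} → RootWalk H S (x ∷ ys) → Unique (x ∷ ys) → x ≢ v → RootWalk H S′ (x ∷ ys)
  walk-restrict (stop r Sr root) _ r≢v = stop r (S′-intro Sr r≢v) root
  walk-restrict walk@(step x y ys Sx nonroot x~y rest) unique@(_ ∷ unique′) x≢v =
    step x y ys (S′-intro Sx x≢v) nonroot x~y (walk-restrict rest unique′ (walk-second-≢v walk unique))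

  RootPaths-preserved : RootPaths H S → RootPaths H S′
  RootPaths-preserved paths h S′h nonroot =
    let ys , walk , unique = paths h (S′⊆S h S′h) nonroot
    in ys , walk-restrict walk unique (S′-≢ S′h) , unique

  degC-delete : ∀ i h → degC H S i h ≤ degC H S′ i h + indicator (S v ∧ hasColour i (col H h v))
  degC-delete i h = countB-except v λ x x≢v e → ∧-true (S′-intro (∧-trueˡ e) x≢v) (∧-trueʳ e)

  module _ (paths : RootPaths H S) where

    parent : ∃₂ λ p c → ParentIn H S v p × col H v p ≡ just c
    parent with paths v Sv v-nonroot
    ... | [] , stop _ _ v-root , _ = contradiction (trans (sym v-root) v-nonroot) λ ()
    ... | p ∷ zs , path@(step _ _ _ _ _ v~p _ , _) =
      let c , col-vp = is-just⇒≡just v~p in p , c , (zs , path) , col-vp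

    p : Fin m
    p = proj₁ parent

    c : Fin t
    c = proj₁ (proj₂ parent)

    p-parent : ParentIn H S v p
    p-parent = proj₁ (proj₂ (proj₂ parent))

    col-vp : col H v p ≡ just c
    col-vp = proj₂ (proj₂ (proj₂ parent))

    leaf-neighbour : ∀ {y i} → S y ≡ true → col H v y ≡ just i → y ≡ p × i ≡ c
    leaf-neighbour Sy col-vy
      with neighbour-unique Sy (cong is-just col-vy) (ParentIn-∈ p-parent) (cong is-just col-vp)
    ... | refl = refl , just-injective (trans (sym col-vy) col-vp)

    degC-leaf : ∀ i → degC H S i v ≤ indicator ⌊ i ≟ c ⌋
    degC-leaf i with i ≟ c
    ... | yes refl = ≤-trans
      (countB-mono λ y e → ∧-true (∧-trueˡ {S y} e) (cong is-just (hasColour⇒≡just (∧-trueʳ {S y} e))))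
      (≤-reflexive deg-v)
    ... | no i≢c = ≤-trans
      (countB-mono λ y e →
         contradiction (proj₂ (leaf-neighbour (∧-trueˡ {S y} e) (hasColour⇒≡just (∧-trueʳ {S y} e)))) i≢c)
      (≤-reflexive (countB-false m))

    module _ {n} (G : Family n t) (φ : Fin m → Fin n) (emb : Embedding G H φ) where

      open import Data.List.Membership.DecPropositional (_≟ₚ_ {n} {t}) using (_∈?_)

      φ-inj : Injective _≡_ _≡_ φ
      φ-inj = proj₁ emb

      leaf-pair parent-pair : Fin n × Fin t
      leaf-pair = φ v , c
      parent-pair = φ p , c

      at-leaf-pair at-parent-pair : Fin n × Fin t → ℕ
      at-leaf-pair x = indicator ⌊ x ≟ₚ leaf-pair ⌋
      at-parent-pair x = indicator ⌊ x ≟ₚ parent-pair ⌋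

      InP-mono : ∀ {a} → InP G H S′ φ a → InP G H S φ a
      InP-mono (h , q , i , (ys , walk , unique) , col-hq , a≡) =
        h , q , i , (ys , walk-mono S′⊆S walk , unique) , col-hq , a≡

      leaf-pair∉InP′ : ¬ InP G H S′ φ leaf-pair
      leaf-pair∉InP′ (h , _ , _ , (_ , walk , _) , _ , leaf-pair≡) =
        S′-≢ (walk-head walk) (φ-inj (cong proj₁ (sym leaf-pair≡)))

      leaf-pair∈InP : InP G H S φ leaf-pair
      leaf-pair∈InP = v , p , c , p-parent , col-vp , refl

      InP-split : ∀ {a} → InP G H S φ a → a ≡ leaf-pair ⊎ InP G H S′ φ a
      InP-split (h , q , i , parent-q@(ys , walk , unique) , col-hq , a≡) with h ≟ v
      ... | yes refl = inj₁ (trans a≡ (cong (φ v ,_) (proj₂ (leaf-neighbour (ParentIn-∈ parent-q) col-hq))))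
      ... | no h≢v = inj₂ (h , q , i , (ys , walk-restrict walk unique h≢v , unique) , col-hq , a≡)

      card-after-removal : ∀ {X k} → Unique X → CardIs (λ a → a ∈ X × InP G H S′ φ a) k →
                           CardIs (λ a → a ∈ X × InP G H S φ a) (k + count _≟ₚ_ leaf-pair X)
      card-after-removal {X} {k} unique card with leaf-pair ∈? X
      ... | yes leaf-pair∈X rewrite count-∈-unique _≟ₚ_ unique leaf-pair∈X | +-comm k 1 =
        CardIs-insert (leaf-pair∉InP′ ∘ proj₂) (leaf-pair∈X , leaf-pair∈InP)
          (λ _ (a∈X , inP) → a∈X , InP-mono inP) (λ _ (a∈X , inP) → Sum.map₂ (a∈X ,_) (InP-split inP)) card
      ... | no leaf-pair∉X rewrite count-∉ _≟ₚ_ leaf-pair∉X | +-identityʳ k =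
        CardIs-resp (λ _ (a∈X , inP) → a∈X , InP-mono inP) restrict-InP card
        where
        restrict-InP : ∀ a → a ∈ X × InP G H S φ a → a ∈ X × InP G H S′ φ a
        restrict-InP a (a∈X , inP) with InP-split inP
        ... | inj₁ refl = contradiction a∈X leaf-pair∉X
        ... | inj₂ inP′ = a∈X , inP′

      φv∈φ[S] : inImage G H S φ (φ v) ≡ true
      φv∈φ[S] = anyFin-intro v (∧-true Sv (⌊⌋-complete (φ v ≟ φ v) refl))

      φv∉φ[S′] : inImage G H S′ φ (φ v) ≡ false
      φv∉φ[S′] = anyFin-false λ h → ∧-false λ S′h → ⌊⌋-false (φ h ≟ φ v) (S′-≢ S′h ∘ φ-inj)

      gammaCount-after-removal : ∀ {X} → Unique X →
        gammaCount G H S φ X + count _≟ₚ_ parent-pair X ≤ gammaCount G H S′ φ X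
      gammaCount-after-removal {X} unique with parent-pair ∈? X
      ... | yes parent-pair∈X
        rewrite count-∈-unique _≟ₚ_ unique parent-pair∈X | +-comm (gammaCount G H S φ X) 1 =
        gammaCount-vacated G H φ S′⊆S X parent-pair∈X (proj₂ emb p v c (trans (csym H p v) col-vp))
          φv∈φ[S] φv∉φ[S′]
      ... | no parent-pair∉X rewrite count-∉ _≟ₚ_ parent-pair∉X | +-identityʳ (gammaCount G H S φ X) =
        gammaCount-antitone G H φ S′⊆S X

      degC-leaf-after-removal : ∀ i → degC H S i v ≤
        degPre G H S′ φ (φ v) i + (at-leaf-pair (φ v , i) + at-parent-pair (φ v , i))
      degC-leaf-after-removal i = begin
        degC H S i v
          ≤⟨ degC-leaf i ⟩
        indicator ⌊ i ≟ c ⌋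
          ≤⟨ indicator-mono (λ i==c → ⌊⌋-complete _ (cong (φ v ,_) (⌊⌋-sound (i ≟ c) i==c))) ⟩
        at-leaf-pair (φ v , i)
          ≤⟨ m≤m+n _ (at-parent-pair (φ v , i)) ⟩
        at-leaf-pair (φ v , i) + at-parent-pair (φ v , i)
          ≤⟨ m≤n+m _ (degPre G H S′ φ (φ v) i) ⟩
        degPre G H S′ φ (φ v) i + (at-leaf-pair (φ v , i) + at-parent-pair (φ v , i)) ∎
        where open ≤-Reasoning

      degC-after-removal : ∀ {h} i → S h ≡ true → degC H S i h ≤
        degPre G H S′ φ (φ h) i + (at-leaf-pair (φ h , i) + at-parent-pair (φ h , i))
      degC-after-removal {h} i Sh with h ≟ v
      ... | yes refl = degC-leaf-after-removal i
      ... | no h≢v = begin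
        degC H S i h
          ≤⟨ degC-delete i h ⟩
        degC H S′ i h + indicator (S v ∧ hasColour i (col H h v))
          ≤⟨ +-mono-≤ (≤-reflexive (sym (degPre-image G H φ φ-inj i (S′-intro Sh h≢v))))
                      (≤-trans edge-to-leaf≤at-parent-pair (m≤n+m _ _)) ⟩
        degPre G H S′ φ (φ h) i + (at-leaf-pair (φ h , i) + at-parent-pair (φ h , i)) ∎
        where
        open ≤-Reasoning
        edge-to-leaf≤at-parent-pair : indicator (S v ∧ hasColour i (col H h v)) ≤ at-parent-pair (φ h , i)
        edge-to-leaf≤at-parent-pair = indicator-mono λ e →
          let h≡p , i≡c = leaf-neighbour Sh (trans (csym H v h) (hasColour⇒≡just (∧-trueʳ e)))
          in ⌊⌋-complete _ (cong₂ _,_ (cong φ h≡p) i≡c)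

      degPre-after-removal : ∀ w i → degPre G H S φ w i ≤
        degPre G H S′ φ w i + (at-leaf-pair (w , i) + at-parent-pair (w , i))
      degPre-after-removal w i with any? (λ h → (S h BoolP.≟ true) ×-dec (φ h ≟ w))
      ... | yes (h , Sh , refl) =
        ≤-trans (≤-reflexive (degPre-image G H φ φ-inj i Sh)) (degC-after-removal i Sh)
      ... | no w∉φ[S] = ≤-trans
        (≤-reflexive (degPre-outside G H φ i λ h Sh φh≡w → w∉φ[S] (h , Sh , φh≡w))) z≤n

      Good-preserved : ∀ {s D} → Good G H S φ s D → Good G H S′ φ s D
      Good-preserved {s} {D} good X unique |X|≤s k card = ℤP.≤-trans
        (good X unique |X|≤s (k + count _≟ₚ_ leaf-pair X) (card-after-removal unique card))
        (residual-mono {γ = gammaCount G H S φ X} {δ = defSum G H S φ D X}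
          (gammaCount-after-removal unique)
          (defSum-mono G H φ at-leaf-pair at-parent-pair degPre-after-removal D X))

module _ {n m t} (G : Family n t) (H : ColGraph m t) (φ : Fin m → Fin n) (emb : Embedding G H φ) (s D : ℕ) where

  Good-along-removals : ∀ {S S′} → RootPaths H S → Good G H S φ s D → Star (RemStep H) S S′ → Good G H S′ φ s D
  Good-along-removals paths good ε = good
  Good-along-removals paths good ((_ , Sv , v-nonroot , deg-v , S′≡S-v) ◅ removals) =
    Good-along-removals (RootPaths-preserved paths) (Good-preserved paths G φ emb good) removals
    where open LeafRemoval H Sv v-nonroot deg-v S′≡S-v

lemma2p4 : ∀ {n m t : ℕ} (s D : ℕ) (G : Family n t) (H' : ColGraph m t)
           → Rooted H' full → MonDegLe H' full D
           → (φ' : Fin m → Fin n) → Embedding G H' φ' → Good G H' full φ' s D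
           → ∀ (S : VSet m) → Obtainable H' S → Good G H' S φ' s D
lemma2p4 s D G H' rooted _ φ' emb good S removals =
  Good-along-removals G H' φ' emb s D (λ h Sh nonroot → proj₁ (rooted h Sh nonroot)) good removals
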